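{- Let $(L;\wedge,\vee,^{\Delta},^{\nabla},0,1)$ be a weakly dicomplemented lattice. Then the set of S-filters of $L$ that are primary filters of $L$ coincides with the set of S-filters $F$ of $L$ such that $F\cap\overline{S}(L)$ is a prime filter of $\overline{S}(L)$.
   Context: A weakly dicomplemented lattice (WDL) is an algebra $(L;\wedge,\vee,^{\Delta},^{\nabla},0,1)$ such that $(L;\wedge,\vee,0,1)$ is a bounded lattice and, for all $x,y\in L$: $x^{\Delta\Delta}\le x$; $x\le y\Rightarrow y^{\Delta}\le x^{\Delta}$; $(x\wedge y)\vee(x\wedge y^{\Delta})=x$; $x^{\nabla\nabla}\ge x$; $x\le y\Rightarrow y^{\nabla}\le x^{\nabla}$; $(x\vee y)\wedge(x\vee y^{\nabla})=x$. A filter of $L$ is a nonempty upward closed subset closed under $\wedge$; it is primary if for every $x\in L$, $x\in F$ or $x^{\Delta}\in F$. $\overline{S}(L)=\{x\in L\mid x^{\Delta\Delta}=x\}$, $x\,\overline{\sqcap}\,y=(x^{\Delta}\vee y^{\Delta})^{\Delta}$. An S-filter of $L$ is a filter $F$ with $x\,\overline{\sqcap}\,y\in F$ whenever $x,y\in F$. A filter of $\overline{S}(L)$ is a nonempty subset of $\overline{S}(L)$ upward closed within $\overline{S}(L)$ and closed under $\overline{\sqcap}$; it is prime if for $x,y\in\overline{S}(L)$, $x\vee y\in E$ implies $x\in E$ or $y\in E$. -}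

module Defs where

open import Level using (Level; _⊔_; suc)
open import Data.Product using (_×_; ∃)
open import Data.Sum using (_⊎_)
open import Relation.Unary using (Pred)
open import Algebra.Lattice.Bundles using (Lattice)

record WDL (c ℓ : Level) : Set (suc (c ⊔ ℓ)) where
  field
    lattice : Lattice c ℓ
  open Lattice lattice public
  infix 4 _≤_
  _≤_ : Carrier → Carrier → Set ℓ
  x ≤ y = (x ∧ y) ≈ x
  infix 9 _ᐞ _ᐁ
  field
    𝟘 𝟙     : Carrier
    𝟘-least : ∀ x → 𝟘 ≤ x
    𝟙-great : ∀ x → x ≤ 𝟙
    _ᐞ      : Carrier → Carrier
    _ᐁ      : Carrier → Carrier
    ΔΔ≤     : ∀ x → (x ᐞ) ᐞ ≤ x
    Δ-anti  : ∀ {x y} → x ≤ y → y ᐞ ≤ x ᐞ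
    Δ-split : ∀ x y → ((x ∧ y) ∨ (x ∧ y ᐞ)) ≈ x
    ≤∇∇     : ∀ x → x ≤ (x ᐁ) ᐁ
    ∇-anti  : ∀ {x y} → x ≤ y → y ᐁ ≤ x ᐁ
    ∇-split : ∀ x y → ((x ∨ y) ∧ (x ∨ y ᐁ)) ≈ x

module _ {c ℓ : Level} (L : WDL c ℓ) where
  open WDL L

  S̄ : Pred Carrier ℓ
  S̄ x = (x ᐞ) ᐞ ≈ x

  _⊓̄_ : Carrier → Carrier → Carrier
  x ⊓̄ y = ((x ᐞ) ∨ (y ᐞ)) ᐞ

  record IsFilter {p : Level} (F : Pred Carrier p) : Set (c ⊔ ℓ ⊔ p) where
    field
      nonempty : ∃ F
      up       : ∀ {x y} → F x → x ≤ y → F y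
      meet     : ∀ {x y} → F x → F y → F (x ∧ y)

  record IsPrimaryFilter {p : Level} (F : Pred Carrier p) : Set (c ⊔ ℓ ⊔ p) where
    field
      filter  : IsFilter F
      primary : ∀ x → F x ⊎ F (x ᐞ)

  record IsSFilter {p : Level} (F : Pred Carrier p) : Set (c ⊔ ℓ ⊔ p) where
    field
      filter : IsFilter F
      sclose : ∀ {x y} → F x → F y → F (x ⊓̄ y)

  record IsFilterOfS̄ {p : Level} (E : Pred Carrier p) : Set (c ⊔ ℓ ⊔ p) where
    field
      subset   : ∀ {x} → E x → S̄ x
      nonempty : ∃ E
      up       : ∀ {x y} → E x → S̄ y → x ≤ y → E y
      sclose   : ∀ {x y} → E x → E y → E (x ⊓̄ y)

  record IsPrimeFilterOfS̄ {p : Level} (E : Pred Carrier p) : Set (c ⊔ ℓ ⊔ p) where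
    field
      filter : IsFilterOfS̄ E
      prime  : ∀ {x y} → S̄ x → S̄ y → E (x ∨ y) → E x ⊎ E y

  _∩S̄ : {p : Level} → Pred Carrier p → Pred Carrier (p ⊔ ℓ)
  (F ∩S̄) x = F x × S̄ x

{-# OPTIONS --safe #-}
module Submission where

-- Every y satisfies y ∨ yᐞ ≈ 𝟙.  Taking y = xᐞ, both joinands lie in S̄(L),
-- so primeness of F ∩ S̄(L) puts xᐞᐞ (hence x) or xᐞ into F.  Conversely, let
-- x, y ∈ S̄(L) with x ∨ y ∈ F.  If neither x nor y is in F, primarity gives
-- xᐞ, yᐞ ∈ F, hence (x ∨ y)ᐞ ≈ xᐞ ⊓̄ yᐞ ∈ F; with z = x ∨ y the S-filter then
-- contains z ⊓̄ zᐞ ≈ 𝟙ᐞ, the least element of S̄(L), and so contains x after all.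

open import Defs
open import Level using (Level)
open import Data.Product using (_×_; _,_; proj₂)
open import Data.Sum using (_⊎_; inj₁; inj₂)
open import Function.Bundles using (_⇔_; mk⇔)
open import Relation.Binary.Bundles using (Poset)
open import Relation.Binary.Lattice using (module Lattice)
open import Relation.Unary using (Pred; _⊆_)
import Algebra.Lattice.Properties.Lattice as LatticeProperties
import Relation.Binary.Lattice.Properties.JoinSemilattice as JoinSemilatticeProperties

module WDLProperties {c ℓ : Level} (L : WDL c ℓ) where
  open WDL L
  open LatticeProperties lattice using (poset; ∨-∧-orderTheoreticLattice)
  private
    module ≤ₙ = Poset poset
    open JoinSemilatticeProperties (Lattice.joinSemilattice ∨-∧-orderTheoreticLattice)
      using () renaming (x≤y⇒x∨y≈y to x≤ₙy⇒x∨y≈y)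

  -- The library's natural order is  x ≈ x ∧ y ; ours is its symmetric form.
  ≤-reflexive : ∀ {x y} → x ≈ y → x ≤ y
  ≤-reflexive x≈y = sym (≤ₙ.reflexive x≈y)

  ≤-trans : ∀ {x y z} → x ≤ y → y ≤ z → x ≤ z
  ≤-trans x≤y y≤z = sym (≤ₙ.trans (sym x≤y) (sym y≤z))

  ≤-antisym : ∀ {x y} → x ≤ y → y ≤ x → x ≈ y
  ≤-antisym x≤y y≤x = ≤ₙ.antisym (sym x≤y) (sym y≤x)

  x≤y⇒x∨y≈y : ∀ {x y} → x ≤ y → (x ∨ y) ≈ y
  x≤y⇒x∨y≈y x≤y = x≤ₙy⇒x∨y≈y (sym x≤y)

  ᐞ-cong : ∀ {x y} → x ≈ y → x ᐞ ≈ y ᐞ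
  ᐞ-cong x≈y = ≤-antisym (Δ-anti (≤-reflexive (sym x≈y))) (Δ-anti (≤-reflexive x≈y))

  x∨xᐞ≈𝟙 : ∀ x → (x ∨ x ᐞ) ≈ 𝟙
  x∨xᐞ≈𝟙 x = trans (∨-cong (sym (𝟙∧ x)) (sym (𝟙∧ (x ᐞ)))) (Δ-split 𝟙 x)
    where
    𝟙∧ : ∀ y → (𝟙 ∧ y) ≈ y
    𝟙∧ y = trans (∧-comm 𝟙 y) (𝟙-great y)

  S̄-resp-≈ : ∀ {x y} → x ≈ y → S̄ L x → S̄ L y
  S̄-resp-≈ x≈y x∈S̄ = trans (ᐞ-cong (ᐞ-cong (sym x≈y))) (trans x∈S̄ x≈y)

  S̄-ᐞ : ∀ x → S̄ L (x ᐞ)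
  S̄-ᐞ x = ≤-antisym (ΔΔ≤ (x ᐞ)) (Δ-anti (ΔΔ≤ x))

  𝟙ᐞ≤ᐞ : ∀ x → 𝟙 ᐞ ≤ x ᐞ
  𝟙ᐞ≤ᐞ x = Δ-anti (𝟙-great x)

  S̄-𝟙 : S̄ L 𝟙
  S̄-𝟙 = ≤-antisym (ΔΔ≤ 𝟙) (≤-reflexive 𝟙≈𝟙ᐞᐞ)
    where
    𝟙≈𝟙ᐞᐞ : 𝟙 ≈ 𝟙 ᐞ ᐞ
    𝟙≈𝟙ᐞᐞ = trans (sym (x∨xᐞ≈𝟙 (𝟙 ᐞ))) (x≤y⇒x∨y≈y (𝟙ᐞ≤ᐞ (𝟙 ᐞ)))

  S̄⇒𝟙ᐞ≤ : ∀ {x} → S̄ L x → 𝟙 ᐞ ≤ x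
  S̄⇒𝟙ᐞ≤ {x} x∈S̄ = ≤-trans (𝟙ᐞ≤ᐞ (x ᐞ)) (≤-reflexive x∈S̄)

  x⊓̄xᐞ≈𝟙ᐞ : ∀ x → _⊓̄_ L x (x ᐞ) ≈ 𝟙 ᐞ
  x⊓̄xᐞ≈𝟙ᐞ x = ᐞ-cong (x∨xᐞ≈𝟙 (x ᐞ))

  ᐞ⊓̄ᐞ≈∨ᐞ : ∀ {x y} → S̄ L x → S̄ L y → _⊓̄_ L (x ᐞ) (y ᐞ) ≈ (x ∨ y) ᐞ
  ᐞ⊓̄ᐞ≈∨ᐞ x∈S̄ y∈S̄ = ᐞ-cong (∨-cong x∈S̄ y∈S̄)

module FilterProperties {c ℓ p : Level} (L : WDL c ℓ) {F : Pred (WDL.Carrier L) p}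
                        (isFilter : IsFilter L F) where
  open WDL L
  open WDLProperties L
  open IsFilter isFilter

  up-≈ : ∀ {x y} → F x → x ≈ y → F y
  up-≈ x∈F x≈y = up x∈F (≤-reflexive x≈y)

  𝟙∈ : F 𝟙
  𝟙∈ = up (proj₂ nonempty) (𝟙-great _)

  ∩S̄-isPrime⇒isPrimary : IsPrimeFilterOfS̄ L (_∩S̄ L F) → IsPrimaryFilter L F
  ∩S̄-isPrime⇒isPrimary isPrime = record { filter = isFilter ; primary = primary }
    where
    primary : ∀ x → F x ⊎ F (x ᐞ)
    primary x with IsPrimeFilterOfS̄.prime isPrime (S̄-ᐞ x) (S̄-ᐞ (x ᐞ))
                     (up-≈ 𝟙∈ (sym (x∨xᐞ≈𝟙 (x ᐞ))) , S̄-resp-≈ (sym (x∨xᐞ≈𝟙 (x ᐞ))) S̄-𝟙)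
    ... | inj₁ (xᐞ∈F , _)  = inj₂ xᐞ∈F
    ... | inj₂ (xᐞᐞ∈F , _) = inj₁ (up xᐞᐞ∈F (ΔΔ≤ x))

module SFilterProperties {c ℓ p : Level} (L : WDL c ℓ) {F : Pred (WDL.Carrier L) p}
                         (isSFilter : IsSFilter L F) where
  open WDL L
  open WDLProperties L
  open IsSFilter isSFilter
  open IsFilter filter
  open FilterProperties L filter

  x∈∧xᐞ∈⇒S̄⊆ : ∀ {x} → F x → F (x ᐞ) → S̄ L ⊆ F
  x∈∧xᐞ∈⇒S̄⊆ {x} x∈F xᐞ∈F y∈S̄ = up (up-≈ (sclose x∈F xᐞ∈F) (x⊓̄xᐞ≈𝟙ᐞ x)) (S̄⇒𝟙ᐞ≤ y∈S̄)

  ∩S̄-isFilterOfS̄ : IsFilterOfS̄ L (_∩S̄ L F)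
  ∩S̄-isFilterOfS̄ = record
    { subset   = proj₂
    ; nonempty = 𝟙 , (𝟙∈ , S̄-𝟙)
    ; up       = λ (x∈F , _) y∈S̄ x≤y → up x∈F x≤y , y∈S̄
    ; sclose   = λ (x∈F , _) (y∈F , _) → sclose x∈F y∈F , S̄-ᐞ _
    }

  isPrimary⇒∩S̄-isPrime : IsPrimaryFilter L F → IsPrimeFilterOfS̄ L (_∩S̄ L F)
  isPrimary⇒∩S̄-isPrime isPrimary = record { filter = ∩S̄-isFilterOfS̄ ; prime = prime }
    where
    open IsPrimaryFilter isPrimary using (primary)
    prime : ∀ {x y} → S̄ L x → S̄ L y → _∩S̄ L F (x ∨ y) → _∩S̄ L F x ⊎ _∩S̄ L F y
    prime {x} {y} x∈S̄ y∈S̄ (x∨y∈F , _) with primary x | primary y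
    ... | inj₁ x∈F  | _         = inj₁ (x∈F , x∈S̄)
    ... | inj₂ _    | inj₁ y∈F  = inj₂ (y∈F , y∈S̄)
    ... | inj₂ xᐞ∈F | inj₂ yᐞ∈F = inj₁ (x∈∧xᐞ∈⇒S̄⊆ x∨y∈F x∨yᐞ∈F x∈S̄ , x∈S̄)
      where
      x∨yᐞ∈F : F ((x ∨ y) ᐞ)
      x∨yᐞ∈F = up-≈ (sclose xᐞ∈F yᐞ∈F) (ᐞ⊓̄ᐞ≈∨ᐞ x∈S̄ y∈S̄)

proposition5p4 : {c ℓ p : Level} (L : WDL c ℓ) (F : Pred (WDL.Carrier L) p) →
    (IsSFilter L F × IsPrimaryFilter L F) ⇔ (IsSFilter L F × IsPrimeFilterOfS̄ L (_∩S̄ L F))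
proposition5p4 L F = mk⇔
  (λ (isSFilter , isPrimary) →
     isSFilter , SFilterProperties.isPrimary⇒∩S̄-isPrime L isSFilter isPrimary)
  (λ (isSFilter , isPrime) →
     isSFilter , FilterProperties.∩S̄-isPrime⇒isPrimary L (IsSFilter.filter isSFilter) isPrime)
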